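{- For every agent $i$ and all formulas $\phi,\psi$ of $\mathbf{LUT}$, $\vDash U_i\phi\land U_i\psi\to U_i(\phi\land\psi)$.
   Context: Let $\mathbf{P}$ be a countably infinite set of propositional variables and $\mathbf{I}$ a finite set of agents. The language $\mathbf{LUT}$ is given by $\phi::= p\mid\neg\phi\mid(\phi\land\phi)\mid K_i\phi\mid[\phi]\phi\mid U_i\phi$ ($p\in\mathbf{P}$, $i\in\mathbf{I}$); $\mathbf{EL}$ is the fragment without $[\cdot]$ and $U_i$. A model is $\mathcal{M}=\langle S,\{R_i\}_{i\in\mathbf{I}},V\rangle$ with $S\neq\emptyset$, each $R_i$ a reflexive relation on $S$, $V:\mathbf{P}\to2^S$. Truth: $p$ true at $s$ iff $s\in V(p)$; Boolean clauses as usual; $\mathcal{M},s\vDash K_i\phi$ iff $\phi$ holds at all $t$ with $sR_it$; $\mathcal{M},s\vDash[\psi]\phi$ iff ($\mathcal{M},s\vDash\psi$ implies $\mathcal{M}|_\psi,s\vDash\phi$), with $\mathcal{M}|_\psi$ the restriction of $\mathcal{M}$ to the states where $\psi$ is true; $\mathcal{M},s\vDash U_i\phi$ iff $\mathcal{M},s\vDash\phi$ and for all $\psi\in\mathbf{EL}$, $\mathcal{M},s\vDash[\psi]\neg K_i\phi$. $\vDash\phi$ means $\phi$ is true at every state of every model. -}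

module Defs where

open import Data.Nat using (ℕ)
open import Data.Fin using (Fin)
open import Data.Product using (Σ; _×_; _,_; proj₁; proj₂)
open import Relation.Nullary using (¬_)

Prop : Set
Prop = ℕ

Agent : ℕ → Set
Agent n = Fin n

infix 40 ¬'_
infixr 30 _∧'_
infixr 20 _⇒'_
infix 10 _,_⊨_ _,_⊨EL_

data LUT (n : ℕ) : Set where
  var  : Prop → LUT n
  ¬'_  : LUT n → LUT n
  _∧'_ : LUT n → LUT n → LUT n
  K    : Agent n → LUT n → LUT n
  [_]_ : LUT n → LUT n → LUT n
  U    : Agent n → LUT n → LUT n

data EL (n : ℕ) : Set where
  var  : Prop → EL n
  ¬'_  : EL n → EL n
  _∧'_ : EL n → EL n → EL n
  K    : Agent n → EL n → EL n

⌜_⌝ : ∀ {n} → EL n → LUT n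
⌜ var p ⌝ = var p
⌜ ¬' φ ⌝ = ¬' ⌜ φ ⌝
⌜ φ ∧' ψ ⌝ = ⌜ φ ⌝ ∧' ⌜ ψ ⌝
⌜ K i φ ⌝ = K i ⌜ φ ⌝

_⇒'_ : ∀ {n} → LUT n → LUT n → LUT n
φ ⇒' ψ = ¬' (φ ∧' ¬' ψ)

record Model (n : ℕ) : Set₁ where
  field
    S     : Set
    inh   : S
    R     : Agent n → S → S → Set
    reflR : ∀ i s → R i s s
    V     : Prop → S → Set
open Model public

restrict : ∀ {n} (M : Model n) (P : S M → Set) (s : S M) → P s → Model n
restrict M P s ps = record
  { S     = Σ (S M) P
  ; inh   = s , ps
  ; R     = λ i t u → R M i (proj₁ t) (proj₁ u)
  ; reflR = λ i t → reflR M i (proj₁ t)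
  ; V     = λ p t → V M p (proj₁ t)
  }

_,_⊨EL_ : ∀ {n} (M : Model n) → S M → EL n → Set
M , s ⊨EL var p = V M p s
M , s ⊨EL (¬' φ) = ¬ (M , s ⊨EL φ)
M , s ⊨EL (φ ∧' ψ) = (M , s ⊨EL φ) × (M , s ⊨EL ψ)
M , s ⊨EL K i φ = ∀ t → R M i s t → M , t ⊨EL φ

_,_⊨_ : ∀ {n} (M : Model n) → S M → LUT n → Set
M , s ⊨ var p = V M p s
M , s ⊨ (¬' φ) = ¬ (M , s ⊨ φ)
M , s ⊨ (φ ∧' ψ) = (M , s ⊨ φ) × (M , s ⊨ ψ)
M , s ⊨ K i φ = ∀ t → R M i s t → M , t ⊨ φ
M , s ⊨ ([ ψ ] φ) =
  (h : M , s ⊨ ψ) → restrict M (λ t → M , t ⊨ ψ) s h , (s , h) ⊨ φ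
-- M,s ⊨ U_i φ  iff  M,s ⊨ φ and for all χ ∈ EL, M,s ⊨ [χ]¬K_i φ
-- (the clause M,s ⊨ [χ]¬K_iφ written out literally, using truth of the
--  EL formula χ; ⊨EL agrees with ⊨ on ⌜ χ ⌝).
M , s ⊨ U i φ =
  (M , s ⊨ φ) ×
  (∀ (χ : EL _) (h : M , s ⊨EL χ) →
     let M' = restrict M (λ t → M , t ⊨EL χ) s h in
     ¬ (∀ t → R M' i (s , h) t → M' , t ⊨ φ))

⊨_ : ∀ {n} → LUT n → Set₁
⊨_ {n} φ = (M : Model n) (s : S M) → M , s ⊨ φ

-- Announcing χ can make agent i know φ ∧ ψ only if it also makes i know φ,
-- so the unknowability of φ alone already yields that of φ ∧ ψ; truth of
-- φ ∧ ψ comes from the truth parts of U i φ and U i ψ.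
module Submission where

open import Data.Nat using (ℕ)
open import Data.Product using (_,_; proj₁)
open import Relation.Nullary using (¬_)
open import Defs

Unknowable : ∀ {n} (M : Model n) → S M → Agent n → LUT n → Set
Unknowable M s i φ =
  ∀ (χ : EL _) (h : M , s ⊨EL χ) →
    ¬ (restrict M (λ t → M , t ⊨EL χ) s h , (s , h) ⊨ K i φ)

K-∧-elimˡ : ∀ {n} {M : Model n} {s i} (φ ψ : LUT n) →
  M , s ⊨ K i (φ ∧' ψ) → M , s ⊨ K i φ
K-∧-elimˡ φ ψ knows t r = proj₁ (knows t r)

Unknowable-∧ˡ : ∀ {n} {M : Model n} {s i} (φ ψ : LUT n) →
  Unknowable M s i φ → Unknowable M s i (φ ∧' ψ)
Unknowable-∧ˡ {M = M} {s} {i} φ ψ unknowable χ h knows =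
  unknowable χ h (K-∧-elimˡ {M = M|χ} {s , h} {i} φ ψ knows)
  where
  M|χ : Model _
  M|χ = restrict M (λ t → M , t ⊨EL χ) s h

U-∧-intro : ∀ {n} {M : Model n} {s i} (φ ψ : LUT n) →
  M , s ⊨ U i φ → M , s ⊨ U i ψ → M , s ⊨ U i (φ ∧' ψ)
U-∧-intro φ ψ (φ-true , φ-unknowable) (ψ-true , _) =
  (φ-true , ψ-true) , Unknowable-∧ˡ φ ψ φ-unknowable

mainTheorem4 : (n : ℕ) (i : Agent n) (φ ψ : LUT n) →
    ⊨ ((U i φ ∧' U i ψ) ⇒' U i (φ ∧' ψ))
mainTheorem4 n i φ ψ M s ((Uφ , Uψ) , ¬U[φ∧ψ]) = ¬U[φ∧ψ] (U-∧-intro φ ψ Uφ Uψ)
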